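{- Let $k$ and $m$ be positive integers such that $\gcd(k,m)=1$ and $m<k<\sigma(m)$. If a positive integer $n$ has abundancy index $\lambda(n)=\frac{k}{k-m}$, then $n$ is not feebly amicable with any other positive integer; that is, there is no positive integer $l\neq n$ with $\frac{1}{\lambda(n)}+\frac{1}{\lambda(l)}=1$.
   Context: For a positive integer $n$, $\sigma(n)$ denotes the sum of all positive divisors of $n$ (including $n$), and the abundancy index is $\lambda(n)=\frac{\sigma(n)}{n}$. Two positive integers $m,n$ are called feebly amicable if $\frac{n}{\sigma(n)}+\frac{m}{\sigma(m)}=1$, equivalently $\frac{1}{\lambda(n)}+\frac{1}{\lambda(m)}=1$. -}

module Defs where

open import Data.Nat using (ℕ; zero; suc; _+_; NonZero; >-nonZero)
open import Data.Nat.Divisibility using (_∣?_; ∣-refl)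
open import Data.Nat.Properties using (m≤m+n)
open import Data.Integer using (+_)
open import Data.Rational using (ℚ; _/_)
open import Relation.Nullary.Decidable using (yes; no)
open import Relation.Nullary.Negation using (contradiction)
open import Relation.Binary.PropositionalEquality using (_≡_)
import Data.Rational

divSumUpTo : ℕ → ℕ → ℕ
divSumUpTo n zero = zero
divSumUpTo n (suc d) with suc d ∣? n
... | yes _ = suc d + divSumUpTo n d
... | no  _ = divSumUpTo n d

σ : ℕ → ℕ
σ n = divSumUpTo n n

σ-nonZero : (n : ℕ) → .{{ NonZero n }} → NonZero (σ n)
σ-nonZero (suc k) with suc k ∣? suc k
... | yes _ = _
... | no ¬p = contradiction ∣-refl ¬p

abundancy : (n : ℕ) → .{{ NonZero n }} → ℚ
abundancy n = (+ σ n) / n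

invAbundancy : (n : ℕ) → .{{ NonZero n }} → ℚ
invAbundancy n = (+ n) / σ n
  where instance _ = σ-nonZero n

FeeblyAmicable : (n l : ℕ) → .{{ NonZero n }} → .{{ NonZero l }} → Set
FeeblyAmicable n l = invAbundancy n Data.Rational.+ invAbundancy l ≡ Data.Rational.1ℚ

-- From λ(n) = k/(k−m), a partner l of n would satisfy 1/λ(l) = 1 − (k−m)/k = m/k, i.e.
-- k·l = m·σ(l). As gcd(k,m) = 1 this forces l = t·m and then σ(l) = t·k. But the divisors
-- e of m give the divisors t·e of t·m, so σ(t·m) ≥ t·σ(m) > t·k — a contradiction.
module Submission where

open import Defs
open import Data.Nat using (ℕ; NonZero; _<_; _∸_; ≢-nonZero; zero; suc; _*_; _+_; _≤_; _≤′_; z≤n; ≤′-refl; ≤′-step)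
open import Data.Nat.Properties
open import Data.Nat.Divisibility using (_∣_; _∣?_; *-monoˡ-∣; divides)
open import Data.Nat.Coprimality using (Coprime; gcd≡1⇒coprime; coprime-divisor)
import Data.Nat.Coprimality as Coprimality
open import Data.Nat.GCD using (gcd)
open import Data.Nat.Solver using (module +-*-Solver)
import Data.Integer as ℤ
open import Data.Integer using (+_)
import Data.Integer.Properties as ℤ
open import Data.Rational using (_/_; 1ℚ; toℚᵘ)
import Data.Rational as ℚ
open import Data.Rational.Properties using (/-injective-≃; toℚᵘ-cong; toℚᵘ-homo-+; toℚᵘ-fromℚᵘ)
open import Data.Rational.Unnormalised using (mkℚᵘ; *≡*; _≃_) renaming (_+_ to _+ᵘ_)
import Data.Rational.Unnormalised.Properties as ℚᵘ
open import Relation.Binary.PropositionalEquality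
open import Relation.Nullary using (¬_; yes; no; contradiction)

open +-*-Solver

/-≡⇒*-≡ : ∀ a b c d .{{_ : NonZero c}} .{{_ : NonZero d}} →
          (+ a) / c ≡ (+ b) / d → a * d ≡ b * c
/-≡⇒*-≡ a b (suc c) (suc d) eq with /-injective-≃ (mkℚᵘ (+ a) c) (mkℚᵘ (+ b) d) eq
... | *≡* e = ℤ.+-injective (trans (ℤ.pos-* a (suc d)) (trans e (sym (ℤ.pos-* b (suc c)))))

/-+-/≡1⇒*-≡ : ∀ a b c d .{{_ : NonZero c}} .{{_ : NonZero d}} →
              (+ a) / c ℚ.+ (+ b) / d ≡ 1ℚ → a * d + b * c ≡ c * d
/-+-/≡1⇒*-≡ a b c@(suc c-1) d@(suc d-1) eq with sum≃1
  where
  sum≃1 : mkℚᵘ (+ a) c-1 +ᵘ mkℚᵘ (+ b) d-1 ≃ toℚᵘ 1ℚ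
  sum≃1 = ℚᵘ.≃-trans
    (ℚᵘ.≃-sym (ℚᵘ.+-cong (toℚᵘ-fromℚᵘ (mkℚᵘ (+ a) c-1)) (toℚᵘ-fromℚᵘ (mkℚᵘ (+ b) d-1))))
    (ℚᵘ.≃-trans (ℚᵘ.≃-sym (toℚᵘ-homo-+ ((+ a) / c) ((+ b) / d))) (toℚᵘ-cong eq))
... | *≡* e = ℤ.+-injective (begin
  + (a * d + b * c)                 ≡⟨ ℤ.pos-+ (a * d) (b * c) ⟩
  + (a * d) ℤ.+ + (b * c)           ≡⟨ cong₂ ℤ._+_ (ℤ.pos-* a d) (ℤ.pos-* b c) ⟩
  + a ℤ.* + d ℤ.+ + b ℤ.* + c       ≡⟨ ℤ.*-identityʳ _ ⟨
  (+ a ℤ.* + d ℤ.+ + b ℤ.* + c) ℤ.* + 1 ≡⟨ e ⟩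
  + 1 ℤ.* + (c * d)                 ≡⟨ ℤ.*-identityˡ _ ⟩
  + (c * d)                         ∎)
  where open ≡-Reasoning

divSumUpTo-monoʳ-≤ : ∀ n {d e} → d ≤ e → divSumUpTo n d ≤ divSumUpTo n e
divSumUpTo-monoʳ-≤ n d≤e = go (≤⇒≤′ d≤e)
  where
  step : ∀ e → divSumUpTo n e ≤ divSumUpTo n (suc e)
  step e with suc e ∣? n
  ... | yes _ = m≤n+m _ (suc e)
  ... | no  _ = ≤-refl
  go : ∀ {d e} → d ≤′ e → divSumUpTo n d ≤ divSumUpTo n e
  go ≤′-refl          = ≤-refl
  go (≤′-step {e} d≤e) = ≤-trans (go d≤e) (step e)

-- Each divisor e ≤ d of m contributes the divisor e·t ≤ d·t of m·t.
*-divSumUpTo-≤ : ∀ m t .{{_ : NonZero t}} d →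
                            t * divSumUpTo m d ≤ divSumUpTo (m * t) (d * t)
*-divSumUpTo-≤ m t@(suc t-1) zero rewrite *-zeroʳ t-1 = z≤n
*-divSumUpTo-≤ m t@(suc t-1) (suc d) with suc d ∣? m
... | no _ = ≤-trans (*-divSumUpTo-≤ m t d)
                     (divSumUpTo-monoʳ-≤ (m * t) (m≤n+m (d * t) t))
... | yes e∣m with suc d * t ∣? m * t
...   | no  e*t∤m*t = contradiction (*-monoˡ-∣ t e∣m) e*t∤m*t
...   | yes _ = begin
  t * (suc d + divSumUpTo m d)            ≡⟨ *-distribˡ-+ t (suc d) _ ⟩
  t * suc d + t * divSumUpTo m d          ≡⟨ cong (_+ t * divSumUpTo m d) (*-comm t (suc d)) ⟩
  suc d * t + t * divSumUpTo m d          ≤⟨ +-monoʳ-≤ (suc d * t) (≤-trans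
                                               (*-divSumUpTo-≤ m t d)
                                               (divSumUpTo-monoʳ-≤ (m * t) (m≤n+m (d * t) t-1))) ⟩
  suc d * t + divSumUpTo (m * t) (t-1 + d * t) ∎
  where open ≤-Reasoning

t*σ[m]≤σ[m*t] : ∀ m t .{{_ : NonZero t}} → t * σ m ≤ σ (m * t)
t*σ[m]≤σ[m*t] m t = *-divSumUpTo-≤ m t m

k*l≢m*σ[l] : ∀ k m l .{{_ : NonZero m}} .{{_ : NonZero l}} →
                 Coprime k m → k < σ m → k * l ≢ m * σ l
k*l≢m*σ[l] k m l@(suc _) k⊥m k<σm kl≡mσl with m∣l
  where
  m∣l : m ∣ l
  m∣l = coprime-divisor (Coprimality.sym k⊥m) (divides (σ l) (trans kl≡mσl (*-comm m (σ l))))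
... | divides t@(suc _) l≡t*m = <⇒≱ k<σm (*-cancelˡ-≤ t (begin
  t * σ m        ≤⟨ t*σ[m]≤σ[m*t] m t ⟩
  σ (m * t)      ≡⟨ cong σ (trans (*-comm m t) (sym l≡t*m)) ⟩
  σ l            ≡⟨ σl≡t*k ⟨
  t * k          ∎))
  where
  open ≤-Reasoning
  σl≡t*k : t * k ≡ σ l
  σl≡t*k = *-cancelˡ-≡ (t * k) (σ l) m (begin-equality
    m * (t * k)  ≡⟨ solve 3 (λ m t k → m :* (t :* k) := k :* (t :* m)) refl m t k ⟩
    k * (t * m)  ≡⟨ cong (k *_) l≡t*m ⟨
    k * l        ≡⟨ kl≡mσl ⟩
    m * σ l      ∎)

-- Cleared of denominators: σ(n)/n = k/d, n/σ(n) + l/σ(l) = 1 and k = d + m give σ(l)/l = k/m.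
partner-abundancy : ∀ n l σn σl k m d .{{_ : NonZero σn}} →
                    σn * d ≡ k * n → n * σl + l * σn ≡ σn * σl → d + m ≡ k → k * l ≡ m * σl
partner-abundancy n l σn σl k m d σn*d≡k*n amicable d+m≡k =
  *-cancelˡ-≡ (k * l) (m * σl) σn (+-cancelˡ-≡ (σn * d * σl) _ _ (begin
    σn * d * σl + σn * (k * l)  ≡⟨ cong (λ x → x * σl + σn * (k * l)) σn*d≡k*n ⟩
    k * n * σl + σn * (k * l)   ≡⟨ solve 5 (λ k n σl σn l → k :* n :* σl :+ σn :* (k :* l)
                                                        := k :* (n :* σl :+ l :* σn)) refl k n σl σn l ⟩
    k * (n * σl + l * σn)       ≡⟨ cong (k *_) amicable ⟩
    k * (σn * σl)               ≡⟨ cong (_* (σn * σl)) d+m≡k ⟨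
    (d + m) * (σn * σl)         ≡⟨ solve 4 (λ d m σn σl → (d :+ m) :* (σn :* σl)
                                                        := σn :* d :* σl :+ σn :* (m :* σl)) refl d m σn σl ⟩
    σn * d * σl + σn * (m * σl) ∎))
  where open ≡-Reasoning

theorem8p1 : (k m : ℕ) → .{{ _ : NonZero k }} → .{{ _ : NonZero m }} →
    gcd k m ≡ 1 → (m<k : m < k) → k < σ m →
    (n : ℕ) → .{{ _ : NonZero n }} →
    abundancy n ≡ _/_ (+ k) (k ∸ m) {{ ≢-nonZero (m>n⇒m∸n≢0 m<k) }} →
    (l : ℕ) → .{{ _ : NonZero l }} → l ≢ n → ¬ FeeblyAmicable n l
theorem8p1 k m gcd≡1 m<k k<σm n λn≡k/d l _ amicable =
  k*l≢m*σ[l] k m l (gcd≡1⇒coprime gcd≡1) k<σm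
    (partner-abundancy n l (σ n) (σ l) k m (k ∸ m)
      (/-≡⇒*-≡ (σ n) k n (k ∸ m) λn≡k/d)
      (/-+-/≡1⇒*-≡ n l (σ n) (σ l) amicable)
      (m∸n+n≡m (<⇒≤ m<k)))
  where
  instance
    _ = ≢-nonZero (m>n⇒m∸n≢0 m<k)
    _ = σ-nonZero n
    _ = σ-nonZero l
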